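{- Let $N\ge1$ and let $h:G_N\to\mathbb C$ be a nonzero function which factors through $r_N$. Suppose that $h(\alpha_1\beta_1)h(\alpha_2\beta_2)=h(\alpha_1\beta_2)h(\alpha_2\beta_1)$ for all $\alpha_1,\alpha_2,\beta_1,\beta_2\in G_N$ such that, for every prime $p$, $|\alpha_1|_p\ne1$ or $|\alpha_2|_p\neq1$ implies $|\beta_1|_p=|\beta_2|_p=1$. Then there exist a Dirichlet character $\psi$ modulo $N$ and a constant $c\in\mathbb C$ such that $h(\alpha)=c\,\psi(r_N(\alpha))$ for all $\alpha\in G_N$.
   Context: $G_N$ is the subgroup of $\mathbb Q^\times$ generated by the primes not dividing $N$; $r_N:G_N\to(\mathbb Z/N\mathbb Z)^\times$ is the homomorphism $m/n\mapsto m\bar n$ for integers $m,n$ coprime to $N$ (and to each other), $\bar n$ the inverse of $n$ mod $N$. $|\cdot|_p$ is the $p$-adic absolute value. -}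

module Defs where

open import Level using (Level; _⊔_) renaming (suc to lsuc)
open import Algebra.Bundles using (CommutativeRing)
open import Data.Nat as ℕ using (ℕ; NonZero)
open import Data.Nat.DivMod using (_mod_)
open import Data.Nat.Coprimality using (Coprime)
open import Data.Nat.Primality using (Prime)
open import Data.Nat.Divisibility as ℕD using ()
open import Data.Fin using (Fin; toℕ)
open import Data.Integer as ℤ using (ℤ; +_; 0ℤ; ∣_∣)
open import Data.Integer.Divisibility as ℤD using ()
open import Data.Rational using (ℚ; ↥_; ↧_; ↧ₙ_)
open import Data.Product using (Σ; _×_)
open import Relation.Nullary using (¬_)
open import Relation.Binary.PropositionalEquality using (_≡_)

record Field (c ℓ : Level) : Set (lsuc (c ⊔ ℓ)) where
  field
    commutativeRing : CommutativeRing c ℓ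
  open CommutativeRing commutativeRing public
  field
    1≉0     : ¬ (1# ≈ 0#)
    inverse : ∀ x → ¬ (x ≈ 0#) → Σ Carrier (λ y → (x * y) ≈ 1#)

-- Membership in G_N: the subgroup of ℚ^× generated by the primes not dividing N,
-- i.e. nonzero rationals whose (reduced) numerator and denominator are coprime to N.
InG : ℕ → ℚ → Set
InG N q = (¬ (↥ q ≡ 0ℤ)) × Coprime ∣ ↥ q ∣ N × Coprime (↧ₙ q) N

-- |q|_p = 1  (p-adic valuation of q is 0): since ℚ is stored in lowest terms,
-- this means p divides neither the numerator nor the denominator.
AbsOne : ℕ → ℚ → Set
AbsOne p q = (¬ (p ℕD.∣ ∣ ↥ q ∣)) × (¬ (p ℕD.∣ ↧ₙ q))

-- Graph of r_N : G_N → (ℤ/Nℤ)^×,  m/n ↦ m n̄ :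
-- r_N(q) = u  iff  u · n ≡ m (mod N), where q = m/n in lowest terms.
-- (For q ∈ G_N there is exactly one such u : Fin N.)
rN-graph : (N : ℕ) → ℚ → Fin N → Set
rN-graph N q u = (+ N) ℤD.∣ ((+ toℕ u) ℤ.* (↧ q) ℤ.- (↥ q))

record IsDirichletChar {c ℓ} (K : Field c ℓ) (N : ℕ) .{{_ : NonZero N}}
                       (ψ : Fin N → Field.Carrier K) : Set (c ⊔ ℓ) where
  open Field K
  field
    one  : ψ (1 mod N) ≈ 1#
    mult : ∀ a b → ψ ((toℕ a ℕ.* toℕ b) mod N) ≈ (ψ a * ψ b)
    unit : ∀ a → Coprime (toℕ a) N → ¬ (ψ a ≈ 0#)
    nonunit : ∀ a → ¬ Coprime (toℕ a) N → ψ a ≈ 0#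

{-# OPTIONS --safe #-}
-- For units a, b modulo N choose coprime integers A ≡ a and B ≡ b (mod N).  With α₁ = A,
-- β₁ = B and α₂ = β₂ = 1 no prime divides both an α and a β, so the hypothesis gives
-- h(AB) h(1) = h(A) h(B), i.e. f(ab) f(1) = f(a) f(b) for the function f on ℤ/N through which
-- h factors.  As h ≠ 0, some f(u₀) ≠ 0, hence f(1) ≠ 0 and f vanishes at no unit; so
-- ψ = f / f(1) on units, extended by 0, is a Dirichlet character and h = f(1) · ψ ∘ r_N.
module Submission where

open import Defs
open import Level using (Level)
open import Data.Nat using (ℕ; NonZero)
open import Data.Nat.Primality using (Prime)
open import Data.Fin using (Fin)
open import Data.Rational using (ℚ; _*_)
open import Data.Product using (Σ; _×_)
open import Data.Sum using (_⊎_)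
open import Relation.Nullary using (¬_)

open import Level using (0ℓ)
import Data.Nat as ℕ
import Data.Nat.Properties as ℕ
open import Data.Nat.DivMod using (_mod_; _%_)
open import Data.Nat.Coprimality as Coprime
  using (Coprime; coprime?; coprime-Bézout; coprime-divisor; 1-coprimeTo)
open import Data.Nat.GCD using (module Bézout)
import Data.Nat.Divisibility as ℕ
open import Data.Nat.Primality using (¬prime[1])
open import Data.Fin using (toℕ; fromℕ<)
open import Data.Fin.Properties using (toℕ-fromℕ<)
open import Data.Integer as ℤ using (ℤ; +_; 0ℤ; 1ℤ; ∣_∣; _+_; _-_; -_)
import Data.Integer.Properties as ℤ
open import Data.Integer.DivMod using (_%ℕ_; _/ℕ_; n%ℕd<d; a≡a%ℕn+[a/ℕn]*n)
open import Data.Integer.Divisibility.Signed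
  using (_∣_; divides; ∣ᵤ⇒∣; ∣⇒∣ᵤ; ∣-trans; ∣m⇒∣-m; ∣m∣n⇒∣m+n; ∣m∣n⇒∣m-n; ∣n⇒∣m*n; ∣m⇒∣m*n)
open import Data.Integer.Tactic.RingSolver using (solve-∀)
open import Data.Rational using (mkℚ; 1ℚ; ↥_; ↧_)
import Data.Rational.Properties as ℚ
open import Data.Product using (_,_; proj₁; proj₂)
open import Data.Sum using (inj₁; inj₂; [_,_]′)
open import Relation.Binary.Bundles using (Setoid)
open import Relation.Binary.PropositionalEquality as ≡ using (_≡_; _≢_)
open import Relation.Nullary using (yes; no; contradiction)
open import Data.Empty using (⊥-elim)

infix 4 _≡_[mod_]

record _≡_[mod_] (x y m : ℤ) : Set where
  constructor congruent
  field modulus∣difference : m ∣ x - y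

module _ {m : ℤ} where

  ≡[mod]-reflexive : ∀ {x y} → x ≡ y → x ≡ y [mod m ]
  ≡[mod]-reflexive {x} ≡.refl = congruent (divides 0ℤ (ℤ.+-inverseʳ x))

  ≡[mod]-refl : ∀ {x} → x ≡ x [mod m ]
  ≡[mod]-refl = ≡[mod]-reflexive ≡.refl

  ≡[mod]-sym : ∀ {x y} → x ≡ y [mod m ] → y ≡ x [mod m ]
  ≡[mod]-sym {x} {y} (congruent m∣x-y) = congruent (≡.subst (m ∣_) (negate x y) (∣m⇒∣-m m∣x-y))
    where
    negate : ∀ x y → - (x - y) ≡ y - x
    negate = solve-∀

  ≡[mod]-trans : ∀ {x y z} → x ≡ y [mod m ] → y ≡ z [mod m ] → x ≡ z [mod m ]
  ≡[mod]-trans {x} {y} {z} (congruent m∣x-y) (congruent m∣y-z) =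
    congruent (≡.subst (m ∣_) (telescope x y z) (∣m∣n⇒∣m+n m∣x-y m∣y-z))
    where
    telescope : ∀ x y z → (x - y) + (y - z) ≡ x - z
    telescope = solve-∀

  ≡[mod]-+ˡ : ∀ z {x y} → x ≡ y [mod m ] → z + x ≡ z + y [mod m ]
  ≡[mod]-+ˡ z {x} {y} (congruent m∣x-y) = congruent (≡.subst (m ∣_) (regroup z x y) m∣x-y)
    where
    regroup : ∀ z x y → x - y ≡ (z + x) - (z + y)
    regroup = solve-∀

  ≡[mod]-*ˡ : ∀ z {x y} → x ≡ y [mod m ] → z ℤ.* x ≡ z ℤ.* y [mod m ]
  ≡[mod]-*ˡ z {x} {y} (congruent m∣x-y) =
    congruent (≡.subst (m ∣_) (distrib z x y) (∣n⇒∣m*n z m∣x-y))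
    where
    distrib : ∀ z x y → z ℤ.* (x - y) ≡ z ℤ.* x - z ℤ.* y
    distrib = solve-∀

  ≡[mod]-*ʳ : ∀ z {x y} → x ≡ y [mod m ] → x ℤ.* z ≡ y ℤ.* z [mod m ]
  ≡[mod]-*ʳ z {x} {y} (congruent m∣x-y) =
    congruent (≡.subst (m ∣_) (distrib z x y) (∣m⇒∣m*n z m∣x-y))
    where
    distrib : ∀ z x y → (x - y) ℤ.* z ≡ x ℤ.* z - y ℤ.* z
    distrib = solve-∀

  ≡[mod]-+-multiple : ∀ x k → x + k ℤ.* m ≡ x [mod m ]
  ≡[mod]-+-multiple x k = congruent (divides k (cancel x (k ℤ.* m)))
    where
    cancel : ∀ x y → x + y - x ≡ y
    cancel = solve-∀

  ∣-respects-≡[mod] : ∀ {d x y} → d ∣ m → x ≡ y [mod m ] → d ∣ y → d ∣ x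
  ∣-respects-≡[mod] {d} {x} {y} d∣m (congruent m∣x-y) d∣y =
    ≡.subst (d ∣_) (cancel x y) (∣m∣n⇒∣m+n (∣-trans d∣m m∣x-y) d∣y)
    where
    cancel : ∀ x y → (x - y) + y ≡ x
    cancel = solve-∀

≡[mod]-setoid : ℤ → Setoid 0ℓ 0ℓ
≡[mod]-setoid m = record
  { Carrier       = ℤ
  ; _≈_           = _≡_[mod m ]
  ; isEquivalence = record { refl = ≡[mod]-refl ; sym = ≡[mod]-sym ; trans = ≡[mod]-trans }
  }

pos-+-* : ∀ a b c → + (a ℕ.+ b ℕ.* c) ≡ + a + + b ℤ.* + c
pos-+-* a b c = ≡.trans (ℤ.pos-+ a (b ℕ.* c)) (≡.cong (_+_ (+ a)) (ℤ.pos-* b c))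

coprime-respects-≡[mod] : ∀ {N x y} → x ≡ y [mod + N ] → Coprime ∣ y ∣ N → Coprime ∣ x ∣ N
coprime-respects-≡[mod] {N} {x} {y} x≡y coprime {d} (d∣x , d∣N) =
  coprime (∣⇒∣ᵤ d∣y , d∣N)
  where
  d∣y : + d ∣ y
  d∣y = ∣-respects-≡[mod] (∣ᵤ⇒∣ {+ d} {+ N} d∣N) (≡[mod]-sym x≡y) (∣ᵤ⇒∣ {+ d} {x} d∣x)

coprime-* : ∀ {a b n} → Coprime a n → Coprime b n → Coprime (a ℕ.* b) n
coprime-* {a} coprime-a coprime-b {d} (d∣ab , d∣n) = coprime-b (coprime-divisor d⊥a d∣ab , d∣n)
  where
  d⊥a : Coprime d a
  d⊥a (e∣d , e∣a) = coprime-a (e∣a , ℕ.∣-trans e∣d d∣n)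

coprime-*⇒coprimeˡ : ∀ {a} b {n} → Coprime (a ℕ.* b) n → Coprime a n
coprime-*⇒coprimeˡ b coprime (d∣a , d∣n) = coprime (ℕ.∣m⇒∣m*n b d∣a , d∣n)

coprime-*⇒coprimeʳ : ∀ a {b n} → Coprime (a ℕ.* b) n → Coprime b n
coprime-*⇒coprimeʳ a coprime (d∣b , d∣n) = coprime (ℕ.∣n⇒∣m*n a d∣b , d∣n)

prime⇒∤1 : ∀ {p} → Prime p → ¬ p ℕ.∣ 1
prime⇒∤1 p-prime p∣1 = ¬prime[1] (≡.subst Prime (ℕ.∣1⇒≡1 p∣1) p-prime)

∣x-1⇒coprime : ∀ {a x} → a ∣ x - 1ℤ → Coprime ∣ a ∣ ∣ x ∣
∣x-1⇒coprime {a} {x} a∣x-1 {d} (d∣a , d∣x) = ℕ.∣1⇒≡1 (∣⇒∣ᵤ (≡.subst (+ d ∣_) (cancel x) d∣x-[x-1]))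
  where
  d∣x-[x-1] : + d ∣ x - (x - 1ℤ)
  d∣x-[x-1] = ∣m∣n⇒∣m-n (∣ᵤ⇒∣ {i = x} d∣x) (∣-trans (∣ᵤ⇒∣ {i = a} d∣a) a∣x-1)
  cancel : ∀ x → x - (x - 1ℤ) ≡ 1ℤ
  cancel = solve-∀

fromℤ : ℤ → ℚ
fromℤ z = mkℚ z 0 (Coprime.sym (1-coprimeTo ∣ z ∣))

fromℤ-* : ∀ x y → fromℤ x * fromℤ y ≡ fromℤ (x ℤ.* y)
fromℤ-* x y = ℚ.↥p/↧p≡p (fromℤ (x ℤ.* y))

module _ (N : ℕ) .{{_ : NonZero N}} where

  open import Relation.Binary.Reasoning.Setoid (≡[mod]-setoid (+ N))

  residue : ℤ → Fin N
  residue z = fromℕ< (n%ℕd<d z N)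

  residue-≡ : ∀ z → + toℕ (residue z) ≡ z [mod + N ]
  residue-≡ z = begin
    + toℕ (residue z)                   ≡⟨ ≡.cong +_ (toℕ-fromℕ< (n%ℕd<d z N)) ⟩
    + (z %ℕ N)                          ≈⟨ ≡[mod]-+-multiple (+ (z %ℕ N)) (z /ℕ N) ⟨
    + (z %ℕ N) + (z /ℕ N) ℤ.* + N       ≡⟨ a≡a%ℕn+[a/ℕn]*n z N ⟨
    z                                   ∎

  -- The middle step holds because (+ n) %ℕ N reduces to n % N.
  mod-≡ : ∀ n → + toℕ (n mod N) ≡ + n [mod + N ]
  mod-≡ n = begin
    + toℕ (n mod N)                     ≡⟨ ≡.cong +_ (toℕ-fromℕ< _) ⟩
    + (n % N)                           ≡⟨ ≡.cong +_ (toℕ-fromℕ< _) ⟨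
    + toℕ (residue (+ n))               ≈⟨ residue-≡ (+ n) ⟩
    + n                                 ∎

  coprime-mod : ∀ {n} → Coprime n N → Coprime (toℕ (n mod N)) N
  coprime-mod = coprime-respects-≡[mod] (mod-≡ _)

  coprime-mod⁻¹ : ∀ {n} → Coprime (toℕ (n mod N)) N → Coprime n N
  coprime-mod⁻¹ = coprime-respects-≡[mod] (≡[mod]-sym (mod-≡ _))

  inverse-mod : ∀ {a} → Coprime a N → Σ ℤ λ s → s ℤ.* + a ≡ 1ℤ [mod + N ]
  inverse-mod {a} a⊥N with coprime-Bézout a⊥N
  ... | Bézout.+- x y 1+yN≡xa = + x , (begin
    + x ℤ.* + a                         ≡⟨ ℤ.pos-* x a ⟨
    + (x ℕ.* a)                         ≡⟨ ≡.cong +_ 1+yN≡xa ⟨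
    + (1 ℕ.+ y ℕ.* N)                   ≡⟨ pos-+-* 1 y N ⟩
    1ℤ + + y ℤ.* + N                    ≈⟨ ≡[mod]-+-multiple 1ℤ (+ y) ⟩
    1ℤ                                  ∎)
  ... | Bézout.-+ x y 1+xa≡yN = - + x , (begin
    - + x ℤ.* + a                       ≈⟨ ≡[mod]-+-multiple _ (+ y) ⟨
    - + x ℤ.* + a + + y ℤ.* + N         ≡⟨ ≡.cong (_+_ (- + x ℤ.* + a)) (ℤ.pos-* y N) ⟨
    - + x ℤ.* + a + + (y ℕ.* N)         ≡⟨ ≡.cong (λ t → - + x ℤ.* + a + + t) 1+xa≡yN ⟨
    - + x ℤ.* + a + + (1 ℕ.+ x ℕ.* a)   ≡⟨ ≡.cong (_+_ (- + x ℤ.* + a)) (pos-+-* 1 x a) ⟩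
    - + x ℤ.* + a + (1ℤ + + x ℤ.* + a)  ≡⟨ cancel (+ x) (+ a) ⟩
    1ℤ                                  ∎)
    where
    cancel : ∀ x a → - x ℤ.* a + (1ℤ + x ℤ.* a) ≡ 1ℤ
    cancel = solve-∀

  inverse-residue : ∀ {a} → Coprime a N → Σ (Fin N) λ a⁻¹ → + (a ℕ.* toℕ a⁻¹) ≡ 1ℤ [mod + N ]
  inverse-residue {a} a⊥N with inverse-mod a⊥N
  ... | s , sa≡1 = residue s , (begin
    + (a ℕ.* toℕ (residue s))   ≡⟨ ℤ.pos-* a (toℕ (residue s)) ⟩
    + a ℤ.* + toℕ (residue s)   ≈⟨ ≡[mod]-*ˡ (+ a) (residue-≡ s) ⟩
    + a ℤ.* s                   ≡⟨ ℤ.*-comm (+ a) s ⟩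
    s ℤ.* + a                   ≈⟨ sa≡1 ⟩
    1ℤ                          ∎)

  record CoprimeLift (a b : ℤ) : Set where
    field
      A B : ℤ
      A≡a : A ≡ a [mod + N ]
      B≡b : B ≡ b [mod + N ]
      A≢0 : A ≢ 0ℤ
      B≢0 : B ≢ 0ℤ
      A⊥B : Coprime ∣ A ∣ ∣ B ∣

  -- B ≡ 1 (mod A) makes A and B coprime, and A ≥ 2 rules out B = 0.
  coprime-lift : ∀ {a} b → Coprime a N → CoprimeLift (+ a) (+ b)
  coprime-lift {a} b a⊥N = record
    { A = + n ; B = B ; A≡a = A≡a ; B≡b = B≡b ; A≢0 = A≢0 ; B≢0 = B≢0 ; A⊥B = A⊥B }
    where
    n : ℕ
    n = a ℕ.+ 2 ℕ.* N

    1<n : 1 ℕ.< n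
    1<n = ℕ.≤-trans (ℕ.*-monoʳ-≤ 2 (ℕ.>-nonZero⁻¹ N)) (ℕ.m≤n+m (2 ℕ.* N) a)

    A≡a : + n ≡ + a [mod + N ]
    A≡a = begin
      + n                     ≡⟨ pos-+-* a 2 N ⟩
      + a + + 2 ℤ.* + N       ≈⟨ ≡[mod]-+-multiple (+ a) (+ 2) ⟩
      + a                     ∎

    s : ℤ
    s = proj₁ (inverse-mod a⊥N)

    sA≡1 : s ℤ.* + n ≡ 1ℤ [mod + N ]
    sA≡1 = ≡[mod]-trans (≡[mod]-*ˡ s A≡a) (proj₂ (inverse-mod a⊥N))

    B : ℤ
    B = 1ℤ + (+ b - 1ℤ) ℤ.* (s ℤ.* + n)

    B≡b : B ≡ + b [mod + N ]
    B≡b = begin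
      1ℤ + (+ b - 1ℤ) ℤ.* (s ℤ.* + n)  ≈⟨ ≡[mod]-+ˡ 1ℤ (≡[mod]-*ˡ (+ b - 1ℤ) sA≡1) ⟩
      1ℤ + (+ b - 1ℤ) ℤ.* 1ℤ           ≡⟨ simplify (+ b) ⟩
      + b                              ∎
      where
      simplify : ∀ b → 1ℤ + (b - 1ℤ) ℤ.* 1ℤ ≡ b
      simplify = solve-∀

    A∣B-1 : + n ∣ B - 1ℤ
    A∣B-1 = divides ((+ b - 1ℤ) ℤ.* s) (regroup (+ b) s (+ n))
      where
      regroup : ∀ b s n → 1ℤ + (b - 1ℤ) ℤ.* (s ℤ.* n) - 1ℤ ≡ (b - 1ℤ) ℤ.* s ℤ.* n
      regroup = solve-∀

    A⊥B : Coprime n ∣ B ∣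
    A⊥B = ∣x-1⇒coprime {+ n} {B} A∣B-1

    A≢0 : + n ≢ 0ℤ
    A≢0 A≡0 = ℕ.m<n⇒n≢0 1<n (ℤ.+-injective A≡0)

    B≢0 : B ≢ 0ℤ
    B≢0 B≡0 = ℕ.<⇒≢ 1<n (≡.sym (A⊥B (ℕ.∣-refl , n∣B)))
      where
      n∣B : n ℕ.∣ ∣ B ∣
      n∣B = ≡.subst (n ℕ.∣_) (≡.sym (≡.cong ∣_∣ B≡0)) (n ℕ.∣0)

  rN-graph⇒≡[mod] : ∀ q u → rN-graph N q u → + toℕ u ℤ.* ↧ q ≡ ↥ q [mod + N ]
  rN-graph⇒≡[mod] _ _ g = congruent (∣ᵤ⇒∣ g)

  ≡[mod]⇒rN-graph : ∀ q u → + toℕ u ℤ.* ↧ q ≡ ↥ q [mod + N ] → rN-graph N q u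
  ≡[mod]⇒rN-graph _ _ (congruent N∣uq-q) = ∣⇒∣ᵤ N∣uq-q

  rN-graph⇒coprime : ∀ q u → InG N q → rN-graph N q u → Coprime (toℕ u) N
  rN-graph⇒coprime q u (_ , ↥q⊥N , _) g = coprime-*⇒coprimeˡ ∣ ↧ q ∣ u↧q⊥N
    where
    u↧q⊥N : Coprime (toℕ u ℕ.* ∣ ↧ q ∣) N
    u↧q⊥N = ≡.subst (λ t → Coprime t N) (ℤ.abs-* (+ toℕ u) (↧ q))
              (coprime-respects-≡[mod] (rN-graph⇒≡[mod] q u g) ↥q⊥N)

  rN-graph-exists : ∀ q → InG N q → Σ (Fin N) (rN-graph N q)
  rN-graph-exists q (_ , _ , ↧q⊥N) with inverse-mod ↧q⊥N
  ... | s , s↧q≡1 = residue (↥ q ℤ.* s) , ≡[mod]⇒rN-graph q (residue (↥ q ℤ.* s)) (begin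
    + toℕ (residue (↥ q ℤ.* s)) ℤ.* ↧ q  ≈⟨ ≡[mod]-*ʳ (↧ q) (residue-≡ (↥ q ℤ.* s)) ⟩
    ↥ q ℤ.* s ℤ.* ↧ q                    ≡⟨ ℤ.*-assoc (↥ q) s (↧ q) ⟩
    ↥ q ℤ.* (s ℤ.* ↧ q)                  ≈⟨ ≡[mod]-*ˡ (↥ q) s↧q≡1 ⟩
    ↥ q ℤ.* 1ℤ                           ≡⟨ ℤ.*-identityʳ (↥ q) ⟩
    ↥ q                                  ∎)

  InG-fromℤ : ∀ {z} → z ≢ 0ℤ → Coprime ∣ z ∣ N → InG N (fromℤ z)
  InG-fromℤ z≢0 z⊥N = z≢0 , z⊥N , 1-coprimeTo N

  InG-1ℚ : InG N 1ℚ
  InG-1ℚ = InG-fromℤ (λ ()) (1-coprimeTo N)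

  rN-graph-fromℤ : ∀ {z u} → + toℕ u ≡ z [mod + N ] → rN-graph N (fromℤ z) u
  rN-graph-fromℤ {z} {u} u≡z = ≡[mod]⇒rN-graph (fromℤ z) u (begin
    + toℕ u ℤ.* 1ℤ  ≡⟨ ℤ.*-identityʳ (+ toℕ u) ⟩
    + toℕ u         ≈⟨ u≡z ⟩
    z               ∎)

  rN-graph-1ℚ : rN-graph N 1ℚ (1 mod N)
  rN-graph-1ℚ = rN-graph-fromℤ (mod-≡ 1)

DisjointlySupported : ℚ → ℚ → ℚ → ℚ → Set
DisjointlySupported α₁ α₂ β₁ β₂ =
  ∀ p → Prime p → (¬ AbsOne p α₁ ⊎ ¬ AbsOne p α₂) → AbsOne p β₁ × AbsOne p β₂

AbsOne-1ℚ : ∀ {p} → Prime p → AbsOne p 1ℚ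
AbsOne-1ℚ p-prime = prime⇒∤1 p-prime , prime⇒∤1 p-prime

coprime⇒disjointlySupported : ∀ A B → Coprime ∣ A ∣ ∣ B ∣ →
                              DisjointlySupported (fromℤ A) 1ℚ (fromℤ B) 1ℚ
coprime⇒disjointlySupported A B A⊥B p p-prime (inj₁ ¬|A|ₚ≡1) =
  (p∤B , prime⇒∤1 p-prime) , AbsOne-1ℚ p-prime
  where
  p∤B : ¬ p ℕ.∣ ∣ B ∣
  p∤B p∣B = ¬|A|ₚ≡1 (p∤A , prime⇒∤1 p-prime)
    where
    p∤A : ¬ p ℕ.∣ ∣ A ∣
    p∤A p∣A = ¬prime[1] (≡.subst Prime (A⊥B (p∣A , p∣B)) p-prime)
coprime⇒disjointlySupported A B A⊥B p p-prime (inj₂ ¬|1|ₚ≡1) =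
  contradiction (AbsOne-1ℚ p-prime) ¬|1|ₚ≡1

module _ {c ℓ} (K : Field c ℓ) where

  open Field K renaming (_*_ to _·_)
  open import Algebra.Properties.CommutativeSemigroup *-commutativeSemigroup using (interchange)
  open import Relation.Binary.Reasoning.Setoid setoid

  x≉0∧y≉0⇒x·y≉0 : ∀ {x y} → x ≉ 0# → y ≉ 0# → x · y ≉ 0#
  x≉0∧y≉0⇒x·y≉0 {x} {y} x≉0 y≉0 xy≈0 with inverse x x≉0 | inverse y y≉0
  ... | x⁻¹ , xx⁻¹≈1 | y⁻¹ , yy⁻¹≈1 = 1≉0 (begin
    1#                     ≈⟨ *-identityʳ 1# ⟨
    1# · 1#                ≈⟨ *-cong xx⁻¹≈1 yy⁻¹≈1 ⟨
    (x · x⁻¹) · (y · y⁻¹)  ≈⟨ interchange x x⁻¹ y y⁻¹ ⟩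
    (x · y) · (x⁻¹ · y⁻¹)  ≈⟨ *-congʳ xy≈0 ⟩
    0# · (x⁻¹ · y⁻¹)       ≈⟨ zeroˡ (x⁻¹ · y⁻¹) ⟩
    0#                     ∎)

  x·y≈1⇒y≉0 : ∀ {x y} → x · y ≈ 1# → y ≉ 0#
  x·y≈1⇒y≉0 {x} xy≈1 y≈0 = 1≉0 (trans (sym xy≈1) (trans (*-congˡ y≈0) (zeroʳ x)))

MultiplicativeUpToScalar : ∀ {c ℓ} (K : Field c ℓ) (N : ℕ) .{{_ : NonZero N}} →
                           (Fin N → Field.Carrier K) → Set ℓ
MultiplicativeUpToScalar K N f =
  ∀ a b u → Coprime (toℕ a) N → Coprime (toℕ b) N → + toℕ u ≡ + (toℕ a ℕ.* toℕ b) [mod + N ] →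
  f u · f (1 mod N) ≈ f a · f b
  where open Field K renaming (_*_ to _·_)

module Character {c ℓ} (K : Field c ℓ) (N : ℕ) .{{_ : NonZero N}} (f : Fin N → Field.Carrier K)
  (f-mult : MultiplicativeUpToScalar K N f)
  (u₀ : Fin N) (u₀⊥N : Coprime (toℕ u₀) N) (fu₀≉0 : Field._≉_ K (f u₀) (Field.0# K)) where

  open Field K renaming (_*_ to _·_)
  open import Algebra.Properties.CommutativeSemigroup *-commutativeSemigroup
    using (interchange; x∙yz≈y∙xz)
  open import Relation.Binary.Reasoning.Setoid setoid

  1ᴺ : Fin N
  1ᴺ = 1 mod N

  1ᴺ⊥N : Coprime (toℕ 1ᴺ) N
  1ᴺ⊥N = coprime-mod N (1-coprimeTo N)

  f1≉0 : f 1ᴺ ≉ 0#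
  f1≉0 f1≈0 = x≉0∧y≉0⇒x·y≉0 K fu₀≉0 fu₀≉0 (begin
    f u₀ · f u₀  ≈⟨ f-mult u₀ u₀ u₀² u₀⊥N u₀⊥N (mod-≡ N _) ⟨
    f u₀² · f 1ᴺ ≈⟨ *-congˡ f1≈0 ⟩
    f u₀² · 0#   ≈⟨ zeroʳ (f u₀²) ⟩
    0#           ∎)
    where
    u₀² : Fin N
    u₀² = (toℕ u₀ ℕ.* toℕ u₀) mod N

  f≉0 : ∀ a → Coprime (toℕ a) N → f a ≉ 0#
  f≉0 a a⊥N fa≈0 = x≉0∧y≉0⇒x·y≉0 K f1≉0 f1≉0 (begin
    f 1ᴺ · f 1ᴺ  ≈⟨ f-mult a a⁻¹ 1ᴺ a⊥N a⁻¹⊥N (≡[mod]-trans (mod-≡ N 1) (≡[mod]-sym aa⁻¹≡1)) ⟩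
    f a · f a⁻¹  ≈⟨ *-congʳ fa≈0 ⟩
    0# · f a⁻¹   ≈⟨ zeroˡ (f a⁻¹) ⟩
    0#           ∎)
    where
    a⁻¹ : Fin N
    a⁻¹ = proj₁ (inverse-residue N a⊥N)

    aa⁻¹≡1 : + (toℕ a ℕ.* toℕ a⁻¹) ≡ 1ℤ [mod + N ]
    aa⁻¹≡1 = proj₂ (inverse-residue N a⊥N)

    a⁻¹⊥N : Coprime (toℕ a⁻¹) N
    a⁻¹⊥N = coprime-*⇒coprimeʳ (toℕ a) (coprime-respects-≡[mod] aa⁻¹≡1 (1-coprimeTo N))

  f1⁻¹ : Carrier
  f1⁻¹ = proj₁ (inverse (f 1ᴺ) f1≉0)

  f1·f1⁻¹≈1 : f 1ᴺ · f1⁻¹ ≈ 1#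
  f1·f1⁻¹≈1 = proj₂ (inverse (f 1ᴺ) f1≉0)

  ψ : Fin N → Carrier
  ψ a with coprime? (toℕ a) N
  ... | yes _ = f a · f1⁻¹
  ... | no  _ = 0#

  ψ-unit : ∀ a → Coprime (toℕ a) N → ψ a ≈ f a · f1⁻¹
  ψ-unit a a⊥N with coprime? (toℕ a) N
  ... | yes _    = refl
  ... | no ¬a⊥N = ⊥-elim (¬a⊥N a⊥N)

  ψ-nonunit : ∀ a → ¬ Coprime (toℕ a) N → ψ a ≈ 0#
  ψ-nonunit a ¬a⊥N with coprime? (toℕ a) N
  ... | yes a⊥N = ⊥-elim (¬a⊥N a⊥N)
  ... | no _     = refl

  ψ-mult : ∀ a b → ψ ((toℕ a ℕ.* toℕ b) mod N) ≈ ψ a · ψ b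
  ψ-mult a b with coprime? (toℕ a) N | coprime? (toℕ b) N
  ... | yes a⊥N | yes b⊥N = begin
    ψ ab                              ≈⟨ ψ-unit ab (coprime-mod N (coprime-* a⊥N b⊥N)) ⟩
    f ab · f1⁻¹                       ≈⟨ *-identityʳ (f ab · f1⁻¹) ⟨
    (f ab · f1⁻¹) · 1#                ≈⟨ *-congˡ f1·f1⁻¹≈1 ⟨
    (f ab · f1⁻¹) · (f 1ᴺ · f1⁻¹)     ≈⟨ interchange (f ab) f1⁻¹ (f 1ᴺ) f1⁻¹ ⟩
    (f ab · f 1ᴺ) · (f1⁻¹ · f1⁻¹)     ≈⟨ *-congʳ (f-mult a b ab a⊥N b⊥N (mod-≡ N _)) ⟩
    (f a · f b) · (f1⁻¹ · f1⁻¹)       ≈⟨ interchange (f a) (f b) f1⁻¹ f1⁻¹ ⟩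
    (f a · f1⁻¹) · (f b · f1⁻¹)       ∎
    where
    ab : Fin N
    ab = (toℕ a ℕ.* toℕ b) mod N
  ... | no ¬a⊥N | _ = trans (ψ-nonunit _ ¬ab⊥N) (sym (zeroˡ _))
    where
    ¬ab⊥N : ¬ Coprime (toℕ ((toℕ a ℕ.* toℕ b) mod N)) N
    ¬ab⊥N ab⊥N = ¬a⊥N (coprime-*⇒coprimeˡ (toℕ b) (coprime-mod⁻¹ N ab⊥N))
  ... | yes _ | no ¬b⊥N = trans (ψ-nonunit _ ¬ab⊥N) (sym (zeroʳ _))
    where
    ¬ab⊥N : ¬ Coprime (toℕ ((toℕ a ℕ.* toℕ b) mod N)) N
    ¬ab⊥N ab⊥N = ¬b⊥N (coprime-*⇒coprimeʳ (toℕ a) (coprime-mod⁻¹ N ab⊥N))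

  ψ≉0 : ∀ a → Coprime (toℕ a) N → ψ a ≉ 0#
  ψ≉0 a a⊥N ψa≈0 =
    x≉0∧y≉0⇒x·y≉0 K (f≉0 a a⊥N) (x·y≈1⇒y≉0 K f1·f1⁻¹≈1) (trans (sym (ψ-unit a a⊥N)) ψa≈0)

  isDirichletChar : IsDirichletChar K N ψ
  isDirichletChar = record
    { one     = trans (ψ-unit 1ᴺ 1ᴺ⊥N) f1·f1⁻¹≈1
    ; mult    = ψ-mult
    ; unit    = ψ≉0
    ; nonunit = ψ-nonunit
    }

  f≈f1·ψ : ∀ a → Coprime (toℕ a) N → f a ≈ f 1ᴺ · ψ a
  f≈f1·ψ a a⊥N = begin
    f a                  ≈⟨ *-identityʳ (f a) ⟨
    f a · 1#             ≈⟨ *-congˡ f1·f1⁻¹≈1 ⟨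
    f a · (f 1ᴺ · f1⁻¹)  ≈⟨ x∙yz≈y∙xz (f a) (f 1ᴺ) f1⁻¹ ⟩
    f 1ᴺ · (f a · f1⁻¹)  ≈⟨ *-congˡ (ψ-unit a a⊥N) ⟨
    f 1ᴺ · ψ a           ∎

module _ {c ℓ} (K : Field c ℓ) (N : ℕ) .{{_ : NonZero N}} (h : ℚ → Field.Carrier K) where

  open Field K renaming (_*_ to _·_)
  open import Relation.Binary.Reasoning.Setoid setoid

  CrossMultiplicative : Set ℓ
  CrossMultiplicative = ∀ α₁ α₂ β₁ β₂ → InG N α₁ → InG N α₂ → InG N β₁ → InG N β₂ →
    DisjointlySupported α₁ α₂ β₁ β₂ → h (α₁ * β₁) · h (α₂ * β₂) ≈ h (α₁ * β₂) · h (α₂ * β₁)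

  h-cong : ∀ {α β} → α ≡ β → h α ≈ h β
  h-cong α≡β = reflexive (≡.cong h α≡β)

  cross-multiplicative⇒coprime-multiplicative : CrossMultiplicative →
    ∀ {A B} → InG N (fromℤ A) → InG N (fromℤ B) → Coprime ∣ A ∣ ∣ B ∣ →
    h (fromℤ (A ℤ.* B)) · h 1ℚ ≈ h (fromℤ A) · h (fromℤ B)
  cross-multiplicative⇒coprime-multiplicative cross {A} {B} A∈G B∈G A⊥B = begin
    h (fromℤ (A ℤ.* B)) · h 1ℚ
      ≈⟨ *-cong (h-cong (fromℤ-* A B)) (h-cong (ℚ.*-identityˡ 1ℚ)) ⟨
    h (fromℤ A * fromℤ B) · h (1ℚ * 1ℚ)
      ≈⟨ cross (fromℤ A) 1ℚ (fromℤ B) 1ℚ A∈G (InG-1ℚ N) B∈G (InG-1ℚ N) disjoint ⟩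
    h (fromℤ A * 1ℚ) · h (1ℚ * fromℤ B)
      ≈⟨ *-cong (h-cong (ℚ.*-identityʳ (fromℤ A))) (h-cong (ℚ.*-identityˡ (fromℤ B))) ⟩
    h (fromℤ A) · h (fromℤ B)
      ∎
    where
    disjoint : DisjointlySupported (fromℤ A) 1ℚ (fromℤ B) 1ℚ
    disjoint = coprime⇒disjointlySupported A B A⊥B

  cross-multiplicative⇒multiplicativeUpToScalar : CrossMultiplicative →
    (f : Fin N → Carrier) → (∀ α u → InG N α → rN-graph N α u → h α ≈ f u) →
    MultiplicativeUpToScalar K N f
  cross-multiplicative⇒multiplicativeUpToScalar cross f h≈f a b u a⊥N b⊥N u≡ab = begin
    f u · f (1 mod N)
      ≈⟨ *-cong (h≈f _ u AB∈G AB↦u) (h≈f 1ℚ (1 mod N) (InG-1ℚ N) (rN-graph-1ℚ N)) ⟨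
    h (fromℤ (A ℤ.* B)) · h 1ℚ
      ≈⟨ cross-multiplicative⇒coprime-multiplicative cross A∈G B∈G A⊥B ⟩
    h (fromℤ A) · h (fromℤ B)
      ≈⟨ *-cong (h≈f _ a A∈G A↦a) (h≈f _ b B∈G B↦b) ⟩
    f a · f b
      ∎
    where
    open CoprimeLift (coprime-lift N (toℕ b) a⊥N)

    AB≡ab : A ℤ.* B ≡ + (toℕ a ℕ.* toℕ b) [mod + N ]
    AB≡ab = ≡[mod]-trans (≡[mod]-*ʳ B A≡a)
              (≡[mod]-trans (≡[mod]-*ˡ (+ toℕ a) B≡b)
                (≡[mod]-reflexive (≡.sym (ℤ.pos-* (toℕ a) (toℕ b)))))

    A∈G : InG N (fromℤ A)
    A∈G = InG-fromℤ N A≢0 (coprime-respects-≡[mod] A≡a a⊥N)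

    B∈G : InG N (fromℤ B)
    B∈G = InG-fromℤ N B≢0 (coprime-respects-≡[mod] B≡b b⊥N)

    AB∈G : InG N (fromℤ (A ℤ.* B))
    AB∈G = InG-fromℤ N (λ AB≡0 → [ A≢0 , B≢0 ]′ (ℤ.i*j≡0⇒i≡0∨j≡0 A AB≡0))
                       (coprime-respects-≡[mod] AB≡ab (coprime-* a⊥N b⊥N))

    A↦a : rN-graph N (fromℤ A) a
    A↦a = rN-graph-fromℤ N (≡[mod]-sym A≡a)

    B↦b : rN-graph N (fromℤ B) b
    B↦b = rN-graph-fromℤ N (≡[mod]-sym B≡b)

    AB↦u : rN-graph N (fromℤ (A ℤ.* B)) u
    AB↦u = rN-graph-fromℤ N (≡[mod]-trans u≡ab (≡[mod]-sym AB≡ab))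

lemma17 : ∀ {c ℓ} (K : Field c ℓ) (N : ℕ) .{{_ : NonZero N}} (h : ℚ → Field.Carrier K) →
    -- h is nonzero on G_N
    Σ ℚ (λ α → InG N α × ¬ (Field._≈_ K (h α) (Field.0# K))) →
    -- h factors through r_N
    Σ (Fin N → Field.Carrier K) (λ f → ∀ α u → InG N α → rN-graph N α u → Field._≈_ K (h α) (f u)) →
    -- the multiplicativity hypothesis on disjointly supported elements
    (∀ α₁ α₂ β₁ β₂ → InG N α₁ → InG N α₂ → InG N β₁ → InG N β₂ →
      (∀ p → Prime p → (¬ AbsOne p α₁ ⊎ ¬ AbsOne p α₂) → AbsOne p β₁ × AbsOne p β₂) →
      Field._≈_ K (Field._*_ K (h (α₁ * β₁)) (h (α₂ * β₂)))
                  (Field._*_ K (h (α₁ * β₂)) (h (α₂ * β₁)))) →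
    Σ (Fin N → Field.Carrier K) (λ ψ → IsDirichletChar K N ψ ×
      Σ (Field.Carrier K) (λ c₀ →
        ∀ α u → InG N α → rN-graph N α u → Field._≈_ K (h α) (Field._*_ K c₀ (ψ u))))
lemma17 K N h (α₀ , α₀∈G , hα₀≉0) (f , h≈f) cross =
  ψ , isDirichletChar , f 1ᴺ ,
  λ α u α∈G α↦u → trans (h≈f α u α∈G α↦u) (f≈f1·ψ u (rN-graph⇒coprime N α u α∈G α↦u))
  where
  open Field K using (_≈_; 0#; trans)

  u₀ : Fin N
  u₀ = proj₁ (rN-graph-exists N α₀ α₀∈G)

  α₀↦u₀ : rN-graph N α₀ u₀
  α₀↦u₀ = proj₂ (rN-graph-exists N α₀ α₀∈G)

  fu₀≉0 : ¬ f u₀ ≈ 0#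
  fu₀≉0 fu₀≈0 = hα₀≉0 (trans (h≈f α₀ u₀ α₀∈G α₀↦u₀) fu₀≈0)

  open Character K N f (cross-multiplicative⇒multiplicativeUpToScalar K N h cross f h≈f)
    u₀ (rN-graph⇒coprime N α₀ u₀ α₀∈G α₀↦u₀) fu₀≉0
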